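{- For all integers $n\ge1$ and all $j=1,\dots,2^n-1$, the denominator of $w_{n,j}(z)$ equals the numerator of $w_{n,j+1}(z)$.
   Context: Let $\mathbb{N}_0=\{0,1,2,\dots\}$ and let $z$ be a variable. A positive linear fractional transformation is an expression $w=\frac{az+b}{cz+d}$ with $a,b,c,d\in\mathbb{N}_0$ and $ad-bc\neq0$. Its numerator is $az+b$ and its denominator is $cz+d$. Define $\frac{w}{w+1}:=\frac{az+b}{(a+c)z+(b+d)}$ and $w+1:=\frac{(a+c)z+(b+d)}{cz+d}$. The rows are defined recursively. Row $0$ is $(w_{0,1})=(z)$, with $z=\frac{1z+0}{0z+1}$. For $n\ge1$, row $n$ is $(w_{n,1}(z),\dots,w_{n,2^n}(z))$, with $w_{n,2i-1}=\frac{w_{n-1,i}}{w_{n-1,i}+1}$ and $w_{n,2i}=w_{n-1,i}+1$ for $i=1,\dots,2^{n-1}$. -}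

module Defs where

open import Data.Nat using (ℕ; zero; suc; _+_; _*_; _^_)
open import Data.Product using (_×_; _,_)
open import Data.Vec using (Vec; []; _∷_)

-- A linear fractional transformation (az+b)/(cz+d) with a,b,c,d ∈ ℕ,
-- recorded by its coefficients.  (The condition ad-bc ≠ 0 holds for all
-- entries of the rows; the row construction preserves ad-bc.)
record LFT : Set where
  constructor lft
  field
    a b c d : ℕ

-- ad - bc ≠ 0, stated over ℕ as a*d ≢ b*c
open import Relation.Binary.PropositionalEquality using (_≢_)
NonDegenerate : LFT → Set
NonDegenerate (lft a b c d) = a * d ≢ b * c

-- numerator az+b and denominator cz+d as coefficient pairs (linear polynomials)
numerator : LFT → ℕ × ℕ
numerator (lft a b c d) = a , b

denominator : LFT → ℕ × ℕ
denominator (lft a b c d) = c , d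


-- w/(w+1) := (az+b)/((a+c)z+(b+d))
left : LFT → LFT
left (lft a b c d) = lft a b (a + c) (b + d)

-- w+1 := ((a+c)z+(b+d))/(cz+d)
right : LFT → LFT
right (lft a b c d) = lft (a + c) (b + d) c d

idLFT : LFT
idLFT = lft 1 0 0 1

open import Data.Vec using (concat; map)
open import Data.Nat.Properties using (*-comm)
open import Relation.Binary.PropositionalEquality using (subst)

expand : ∀ {m} → Vec LFT m → Vec LFT (m * 2)
expand v = concat (map (λ u → left u ∷ right u ∷ []) v)

-- row n = (w_{n,1}, …, w_{n,2^n}), stored 0-based
row : (n : ℕ) → Vec LFT (2 ^ n)
row zero = idLFT ∷ []
row (suc n) = subst (Vec LFT) (*-comm (2 ^ n) 2) (expand (row n))

-- w_{n,j} for 1 ≤ j ≤ 2^n (1-based as in the paper)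
open import Data.Nat using (_≤_; _<_; s≤s)
open import Data.Fin using (fromℕ<)
open import Data.Vec using (lookup)

w : (n j : ℕ) → 1 ≤ j → j ≤ 2 ^ n → LFT
w n (suc j) _ j≤ = lookup (row n) (fromℕ< j≤)

-- The proof is an induction on rows, phrased
-- with the standard library's predicate  Linked  (every consecutive pair of
-- a vector is related).
--   * The children of u are themselves adjacent (the denominator of u/(u+1)
--     is the numerator of u+1), and the children keep the outer data of u:
--     u/(u+1) has the numerator of u, u+1 has the denominator of u.
--   * Hence  expand  maps a linked vector to a linked vector, and so every
--     row is linked (row 0 has one entry; the cast by 2^n*2 = 2*2^n is harmless).
--   * For any relation R, a vector linked by R relates its i-th and (i+1)-th
--     entries; applied to row n this is the theorem.
module Submission where

open import Defs
open import Data.Nat using (ℕ; zero; suc; _^_; _≤_; _<_; s≤s)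
open import Data.Nat.Properties using (<⇒≤; m≤n⇒m≤1+n)
open import Data.Fin using (fromℕ<)
open import Data.Vec using (Vec; []; _∷_; lookup)
open import Data.Vec.Relation.Unary.Linked using (Linked; []; [-]; _∷_)
open import Relation.Binary.Core using (Rel)
open import Relation.Binary.PropositionalEquality using (_≡_; refl; sym; trans; subst)

Adjacent : LFT → LFT → Set
Adjacent u v = denominator u ≡ numerator v

-- The two children of u are adjacent: both sides equal (a+c)z+(b+d).
children-adjacent : (u : LFT) → Adjacent (left u) (right u)
children-adjacent (lft a b c d) = refl

numerator-left : (u : LFT) → numerator (left u) ≡ numerator u
numerator-left (lft a b c d) = refl

denominator-right : (u : LFT) → denominator (right u) ≡ denominator u
denominator-right (lft a b c d) = refl

adjacent-children : (u v : LFT) → Adjacent u v → Adjacent (right u) (left v)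
adjacent-children u v u~v =
  trans (denominator-right u) (trans u~v (sym (numerator-left v)))

expand-cons-linked : ∀ {m} (u : LFT) (v : Vec LFT m) →
  Linked Adjacent (u ∷ v) → Linked Adjacent (left u ∷ right u ∷ expand v)
expand-cons-linked u []      [-]          = children-adjacent u ∷ [-]
expand-cons-linked u (x ∷ v) (u~x ∷ rest) =
  children-adjacent u ∷ adjacent-children u x u~x ∷ expand-cons-linked x v rest

expand-linked : ∀ {m} (v : Vec LFT m) → Linked Adjacent v → Linked Adjacent (expand v)
expand-linked []      []   = []
expand-linked (u ∷ v) link = expand-cons-linked u v link

row-linked : (n : ℕ) → Linked Adjacent (row n)
row-linked zero    = [-]
row-linked (suc n) = cast-linked (expand-linked (row n) (row-linked n))
  where
    cast-linked : ∀ {m k} {e : m ≡ k} {v : Vec LFT m} →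
      Linked Adjacent v → Linked Adjacent (subst (Vec LFT) e v)
    cast-linked {e = refl} link = link

linked-lookup : ∀ {a ℓ} {A : Set a} {R : Rel A ℓ} {m} (v : Vec A m) → Linked R v →
  (j : ℕ) (p : j < m) (q : suc j < m) → R (lookup v (fromℕ< p)) (lookup v (fromℕ< q))
linked-lookup (_ ∷ _ ∷ _) (r ∷ _)    zero    _       _       = r
linked-lookup (_ ∷ v)     (_ ∷ rest) (suc j) (s≤s p) (s≤s q) = linked-lookup v rest j p q
linked-lookup (_ ∷ [])    [-]        zero    _       (s≤s ())

mainTheorem4 : (n j : ℕ) → 1 ≤ n → (h1 : 1 ≤ j) → (h2 : j < 2 ^ n) →
    denominator (w n j h1 (<⇒≤ h2)) ≡ numerator (w n (suc j) (m≤n⇒m≤1+n h1) h2)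
mainTheorem4 n (suc j) _ _ h2 = linked-lookup (row n) (row-linked n) j (<⇒≤ h2) h2
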